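{- For all finite sets of formulas $\Gamma,\Delta$: if $\Gamma\Rightarrow\Delta$ is derivable in $\mathrm{LT}_{\omega}$ without (cut), then the sequent $\neg\Delta,\Gamma\Rightarrow$ (with empty succedent) is derivable in $\mathrm{SLT}_{\omega}$ without (cut), where $\neg\Delta=\{\neg\delta\mid\delta\in\Delta\}$.
   Context: Formulas are built from countably many propositional variables using binary $\to,\wedge,\vee$ and unary $\neg,\mathrm{G},\mathrm{F},\mathrm{X}$; $\mathrm{X}^0\alpha:=\alpha$, $\mathrm{X}^{n+1}\alpha:=\mathrm{X}^n\mathrm{X}\alpha$. $\Gamma,\Delta,\Sigma,\Pi$ denote finite sets of formulas; commas denote union. Derivations are well-founded, possibly infinitely branching trees. In all rules $i,k$ are arbitrary natural numbers, $p$ a propositional variable. $\mathrm{LT}_{\omega}$: sequents $\Gamma\Rightarrow\Delta$. Initial sequents $\mathrm{X}^ip\Rightarrow\mathrm{X}^ip$. Rules: (cut) from $\Gamma\Rightarrow\Delta,\alpha$ and $\alpha,\Sigma\Rightarrow\Pi$ infer $\Gamma,\Sigma\Rightarrow\Delta,\Pi$; (we-left) from $\Gamma\Rightarrow\Delta$ infer $\alpha,\Gamma\Rightarrow\Delta$; (we-right) from $\Gamma\Rightarrow\Delta$ infer $\Gamma\Rightarrow\Delta,\alpha$; ($\to$left) from $\Gamma\Rightarrow\Delta,\mathrm{X}^i\alpha$ and $\mathrm{X}^i\beta,\Gamma\Rightarrow\Delta$ infer $\mathrm{X}^i(\alpha\to\beta),\Gamma\Rightarrow\Delta$; ($\to$right)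 from $\mathrm{X}^i\alpha,\Gamma\Rightarrow\Delta,\mathrm{X}^i\beta$ infer $\Gamma\Rightarrow\Delta,\mathrm{X}^i(\alpha\to\beta)$; ($\neg$left) from $\Gamma\Rightarrow\Delta,\mathrm{X}^i\alpha$ infer $\mathrm{X}^i\neg\alpha,\Gamma\Rightarrow\Delta$; ($\neg$right) from $\mathrm{X}^i\alpha,\Gamma\Rightarrow\Delta$ infer $\Gamma\Rightarrow\Delta,\mathrm{X}^i\neg\alpha$; ($\wedge$left) from $\mathrm{X}^i\alpha,\mathrm{X}^i\beta,\Gamma\Rightarrow\Delta$ infer $\mathrm{X}^i(\alpha\wedge\beta),\Gamma\Rightarrow\Delta$; ($\wedge$right) from $\Gamma\Rightarrow\Delta,\mathrm{X}^i\alpha$ and $\Gamma\Rightarrow\Delta,\mathrm{X}^i\beta$ infer $\Gamma\Rightarrow\Delta,\mathrm{X}^i(\alpha\wedge\beta)$; ($\vee$left) from $\mathrm{X}^i\alpha,\Gamma\Rightarrow\Delta$ and $\mathrm{X}^i\beta,\Gamma\Rightarrow\Delta$ infer $\mathrm{X}^i(\alpha\vee\beta),\Gamma\Rightarrow\Delta$; ($\vee$right) from $\Gamma\Rightarrow\Delta,\mathrm{X}^i\alpha,\mathrm{X}^i\beta$ infer $\Gamma\Rightarrow\Delta,\mathrm{X}^i(\alpha\vee\beta)$; (Gleft) from $\mathrm{X}^{i+k}\alpha,\Gamma\Rightarrow\Delta$ infer $\mathrm{X}^i\mathrm{G}\alpha,\Gamma\Rightarrow\Delta$; (Gright) from all $\Gamma\Rightarrow\Delta,\mathrm{X}^{i+j}\alpha$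 ($j\in\omega$) infer $\Gamma\Rightarrow\Delta,\mathrm{X}^i\mathrm{G}\alpha$; (Fleft) from all $\mathrm{X}^{i+j}\alpha,\Gamma\Rightarrow\Delta$ ($j\in\omega$) infer $\mathrm{X}^i\mathrm{F}\alpha,\Gamma\Rightarrow\Delta$; (Fright) from $\Gamma\Rightarrow\Delta,\mathrm{X}^{i+k}\alpha$ infer $\Gamma\Rightarrow\Delta,\mathrm{X}^i\mathrm{F}\alpha$. $\mathrm{SLT}_{\omega}$: sequents $\Gamma\Rightarrow\gamma$ with $\gamma$ a formula or empty. Initial sequents $\mathrm{X}^ip,\Gamma\Rightarrow\mathrm{X}^ip$. Rules: (cut) from $\Gamma\Rightarrow\alpha$ and $\alpha,\Sigma\Rightarrow\gamma$ infer $\Gamma,\Sigma\Rightarrow\gamma$; (we-right) from $\Gamma\Rightarrow$ infer $\Gamma\Rightarrow\alpha$; ($\to$left) from $\Gamma\Rightarrow\mathrm{X}^i\alpha$ and $\mathrm{X}^i\beta,\Gamma\Rightarrow\gamma$ infer $\mathrm{X}^i(\alpha\to\beta),\Gamma\Rightarrow\gamma$; ($\to$right) from $\mathrm{X}^i\alpha,\Gamma\Rightarrow\mathrm{X}^i\beta$ infer $\Gamma\Rightarrow\mathrm{X}^i(\alpha\to\beta)$; ($\neg$left) from $\Gamma\Rightarrow\mathrm{X}^i\alpha$ infer $\mathrm{X}^i\neg\alpha,\Gamma\Rightarrow$; ($\neg$right) from $\mathrm{X}^i\alpha,\Gamma\Rightarrow$ infer $\Gamma\Rightarrow\mathrm{X}^i\neg\alpha$;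 (ex-middle) from $\mathrm{X}^i\neg\alpha,\Gamma\Rightarrow\gamma$ and $\mathrm{X}^i\alpha,\Gamma\Rightarrow\gamma$ infer $\Gamma\Rightarrow\gamma$; ($\wedge$left) from $\mathrm{X}^i\alpha,\mathrm{X}^i\beta,\Gamma\Rightarrow\gamma$ infer $\mathrm{X}^i(\alpha\wedge\beta),\Gamma\Rightarrow\gamma$; ($\wedge$right) from $\Gamma\Rightarrow\mathrm{X}^i\alpha$ and $\Gamma\Rightarrow\mathrm{X}^i\beta$ infer $\Gamma\Rightarrow\mathrm{X}^i(\alpha\wedge\beta)$; ($\vee$left) from $\mathrm{X}^i\alpha,\Gamma\Rightarrow\gamma$ and $\mathrm{X}^i\beta,\Gamma\Rightarrow\gamma$ infer $\mathrm{X}^i(\alpha\vee\beta),\Gamma\Rightarrow\gamma$; ($\vee$right1/2) from $\Gamma\Rightarrow\mathrm{X}^i\alpha$ (resp. $\Gamma\Rightarrow\mathrm{X}^i\beta$) infer $\Gamma\Rightarrow\mathrm{X}^i(\alpha\vee\beta)$; (Gleft) from $\mathrm{X}^{i+k}\alpha,\Gamma\Rightarrow\gamma$ infer $\mathrm{X}^i\mathrm{G}\alpha,\Gamma\Rightarrow\gamma$; (Gright) from all $\Gamma\Rightarrow\mathrm{X}^{i+j}\alpha$ ($j\in\omega$) infer $\Gamma\Rightarrow\mathrm{X}^i\mathrm{G}\alpha$; (Fleft) from all $\mathrm{X}^{i+j}\alpha,\Gamma\Rightarrow\gamma$ ($j\in\omega$) infer $\mathrm{X}^i\mathrm{F}\alpha,\Gamma\Rightarrow\gamma$;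 (Fright) from $\Gamma\Rightarrow\mathrm{X}^{i+k}\alpha$ infer $\Gamma\Rightarrow\mathrm{X}^i\mathrm{F}\alpha$. -}

module Defs where

open import Data.Nat using (ℕ; zero; suc; _+_)
open import Data.List using (List; []; _∷_; _++_; map)
open import Data.List.Membership.Propositional using (_∈_)
open import Data.Maybe using (Maybe; just; nothing)
open import Data.Product using (_×_)

data Formula : Set where
  var  : ℕ → Formula
  _⇒_  : Formula → Formula → Formula
  _∧_  : Formula → Formula → Formula
  _∨_  : Formula → Formula → Formula
  ¬_   : Formula → Formula
  G    : Formula → Formula
  F    : Formula → Formula
  X    : Formula → Formula

Xⁿ : ℕ → Formula → Formula
Xⁿ zero    a = a
Xⁿ (suc n) a = Xⁿ n (X a)

-- Finite sets of formulas are represented by lists, considered up to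
-- having the same elements.
_≈ₛ_ : List Formula → List Formula → Set
Γ ≈ₛ Γ' = (∀ {x} → x ∈ Γ → x ∈ Γ') × (∀ {x} → x ∈ Γ' → x ∈ Γ)

¬* : List Formula → List Formula
¬* = map ¬_

-- Cut-free LT_ω.  'set' only expresses that sequents consist of sets.
data LTω : List Formula → List Formula → Set where
  set   : ∀ {Γ Γ' Δ Δ'} → Γ ≈ₛ Γ' → Δ ≈ₛ Δ' → LTω Γ Δ → LTω Γ' Δ'
  init  : ∀ i p → LTω (Xⁿ i (var p) ∷ []) (Xⁿ i (var p) ∷ [])
  weL   : ∀ {Γ Δ} α → LTω Γ Δ → LTω (α ∷ Γ) Δ
  weR   : ∀ {Γ Δ} α → LTω Γ Δ → LTω Γ (α ∷ Δ)
  ⇒L    : ∀ {Γ Δ} i α β → LTω Γ (Xⁿ i α ∷ Δ) → LTω (Xⁿ i β ∷ Γ) Δ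
          → LTω (Xⁿ i (α ⇒ β) ∷ Γ) Δ
  ⇒R    : ∀ {Γ Δ} i α β → LTω (Xⁿ i α ∷ Γ) (Xⁿ i β ∷ Δ)
          → LTω Γ (Xⁿ i (α ⇒ β) ∷ Δ)
  ¬L    : ∀ {Γ Δ} i α → LTω Γ (Xⁿ i α ∷ Δ) → LTω (Xⁿ i (¬ α) ∷ Γ) Δ
  ¬R    : ∀ {Γ Δ} i α → LTω (Xⁿ i α ∷ Γ) Δ → LTω Γ (Xⁿ i (¬ α) ∷ Δ)
  ∧L    : ∀ {Γ Δ} i α β → LTω (Xⁿ i α ∷ Xⁿ i β ∷ Γ) Δ
          → LTω (Xⁿ i (α ∧ β) ∷ Γ) Δ
  ∧R    : ∀ {Γ Δ} i α β → LTω Γ (Xⁿ i α ∷ Δ) → LTω Γ (Xⁿ i β ∷ Δ)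
          → LTω Γ (Xⁿ i (α ∧ β) ∷ Δ)
  ∨L    : ∀ {Γ Δ} i α β → LTω (Xⁿ i α ∷ Γ) Δ → LTω (Xⁿ i β ∷ Γ) Δ
          → LTω (Xⁿ i (α ∨ β) ∷ Γ) Δ
  ∨R    : ∀ {Γ Δ} i α β → LTω Γ (Xⁿ i α ∷ Xⁿ i β ∷ Δ)
          → LTω Γ (Xⁿ i (α ∨ β) ∷ Δ)
  GL    : ∀ {Γ Δ} i k α → LTω (Xⁿ (i + k) α ∷ Γ) Δ → LTω (Xⁿ i (G α) ∷ Γ) Δ
  GR    : ∀ {Γ Δ} i α → (∀ j → LTω Γ (Xⁿ (i + j) α ∷ Δ))
          → LTω Γ (Xⁿ i (G α) ∷ Δ)
  FL    : ∀ {Γ Δ} i α → (∀ j → LTω (Xⁿ (i + j) α ∷ Γ) Δ)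
          → LTω (Xⁿ i (F α) ∷ Γ) Δ
  FR    : ∀ {Γ Δ} i k α → LTω Γ (Xⁿ (i + k) α ∷ Δ) → LTω Γ (Xⁿ i (F α) ∷ Δ)

-- Cut-free SLT_ω; succedent is a formula (just γ) or empty (nothing).
data SLTω : List Formula → Maybe Formula → Set where
  set   : ∀ {Γ Γ' γ} → Γ ≈ₛ Γ' → SLTω Γ γ → SLTω Γ' γ
  init  : ∀ {Γ} i p → SLTω (Xⁿ i (var p) ∷ Γ) (just (Xⁿ i (var p)))
  weR   : ∀ {Γ} α → SLTω Γ nothing → SLTω Γ (just α)
  ⇒L    : ∀ {Γ γ} i α β → SLTω Γ (just (Xⁿ i α)) → SLTω (Xⁿ i β ∷ Γ) γ
          → SLTω (Xⁿ i (α ⇒ β) ∷ Γ) γ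
  ⇒R    : ∀ {Γ} i α β → SLTω (Xⁿ i α ∷ Γ) (just (Xⁿ i β))
          → SLTω Γ (just (Xⁿ i (α ⇒ β)))
  ¬L    : ∀ {Γ} i α → SLTω Γ (just (Xⁿ i α)) → SLTω (Xⁿ i (¬ α) ∷ Γ) nothing
  ¬R    : ∀ {Γ} i α → SLTω (Xⁿ i α ∷ Γ) nothing → SLTω Γ (just (Xⁿ i (¬ α)))
  exm   : ∀ {Γ γ} i α → SLTω (Xⁿ i (¬ α) ∷ Γ) γ → SLTω (Xⁿ i α ∷ Γ) γ
          → SLTω Γ γ
  ∧L    : ∀ {Γ γ} i α β → SLTω (Xⁿ i α ∷ Xⁿ i β ∷ Γ) γ
          → SLTω (Xⁿ i (α ∧ β) ∷ Γ) γ
  ∧R    : ∀ {Γ} i α β → SLTω Γ (just (Xⁿ i α)) → SLTω Γ (just (Xⁿ i β))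
          → SLTω Γ (just (Xⁿ i (α ∧ β)))
  ∨L    : ∀ {Γ γ} i α β → SLTω (Xⁿ i α ∷ Γ) γ → SLTω (Xⁿ i β ∷ Γ) γ
          → SLTω (Xⁿ i (α ∨ β) ∷ Γ) γ
  ∨R₁   : ∀ {Γ} i α β → SLTω Γ (just (Xⁿ i α)) → SLTω Γ (just (Xⁿ i (α ∨ β)))
  ∨R₂   : ∀ {Γ} i α β → SLTω Γ (just (Xⁿ i β)) → SLTω Γ (just (Xⁿ i (α ∨ β)))
  GL    : ∀ {Γ γ} i k α → SLTω (Xⁿ (i + k) α ∷ Γ) γ → SLTω (Xⁿ i (G α) ∷ Γ) γ
  GR    : ∀ {Γ} i α → (∀ j → SLTω Γ (just (Xⁿ (i + j) α)))
          → SLTω Γ (just (Xⁿ i (G α)))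
  FL    : ∀ {Γ γ} i α → (∀ j → SLTω (Xⁿ (i + j) α ∷ Γ) γ)
          → SLTω (Xⁿ i (F α) ∷ Γ) γ
  FR    : ∀ {Γ} i k α → SLTω Γ (just (Xⁿ (i + k) α))
          → SLTω Γ (just (Xⁿ i (F α)))

{-# OPTIONS --safe #-}
-- Translate a cut-free LTω derivation of Γ ⇒ Δ by induction, proving ¬Δ, Γ ⇒
-- in any context Σ that contains ¬Δ and Γ; working up to such inclusions makes
-- weakening and contraction free.  Left rules are mirrored by the same SLTω
-- rule.  A right rule introducing φ is mirrored by deriving the single
-- succedent φ and closing with ¬L against ¬φ ∈ Σ.  The step from ¬φ on the
-- left to φ on the right is ex-middle on φ, whose positive branch is the
-- identity sequent φ ⇒ φ, derivable for every formula.  The two-formula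
-- succedent of ∨R is handled by ex-middle on the second disjunct.
module Submission where

open import Defs
open import Data.List using (List; _∷_; _++_)
open import Data.List.Membership.Propositional using (_∈_)
open import Data.List.Relation.Binary.Subset.Propositional using (_⊆_)
open import Data.List.Relation.Binary.Subset.Propositional.Properties
  using (⊆-refl; ⊆-trans; map⁺; xs⊆x∷xs; ∷⁺ʳ; ∈-∷⁺ʳ; xs⊆xs++ys; xs⊆ys++xs)
open import Data.List.Relation.Unary.Any using (here; there)
open import Data.Maybe using (Maybe; just; nothing)
open import Data.Nat using (suc; _+_)
open import Data.Product using (_,_)
open import Relation.Binary.PropositionalEquality using (refl)

private variable
  Γ Δ Σ : List Formula
  γ : Maybe Formula
  φ ψ : Formula

∷⊆⇒⊆ : φ ∷ Γ ⊆ Σ → Γ ⊆ Σ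
∷⊆⇒⊆ s = ⊆-trans (xs⊆x∷xs _ _) s

⊆⇒⊆∷ : Γ ⊆ Σ → Γ ⊆ φ ∷ Σ
⊆⇒⊆∷ s = ⊆-trans s (xs⊆x∷xs _ _)

swap-⊆ : φ ∷ ψ ∷ Γ ⊆ ψ ∷ φ ∷ Γ
swap-⊆ = ∈-∷⁺ʳ (there (here refl)) (∷⁺ʳ _ (xs⊆x∷xs _ _))

swap-≈ₛ : (φ ∷ ψ ∷ Γ) ≈ₛ (ψ ∷ φ ∷ Γ)
swap-≈ₛ = swap-⊆ , swap-⊆

contract : φ ∈ Γ → SLTω (φ ∷ Γ) γ → SLTω Γ γ
contract φ∈Γ = set (∈-∷⁺ʳ φ∈Γ ⊆-refl , xs⊆x∷xs _ _)

identity : ∀ i α Γ → SLTω (Xⁿ i α ∷ Γ) (just (Xⁿ i α))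
identity i (var p) Γ = init i p
identity i (α ⇒ β) Γ =
  ⇒R i α β (set swap-≈ₛ (⇒L i α β (identity i α Γ) (identity i β (Xⁿ i α ∷ Γ))))
identity i (α ∧ β) Γ =
  ∧L i α β (∧R i α β (identity i α (Xⁿ i β ∷ Γ))
                     (set swap-≈ₛ (identity i β (Xⁿ i α ∷ Γ))))
identity i (α ∨ β) Γ = ∨L i α β (∨R₁ i α β (identity i α Γ)) (∨R₂ i α β (identity i β Γ))
identity i (¬ α) Γ = ¬R i α (set swap-≈ₛ (¬L i α (identity i α Γ)))
identity i (G α) Γ = GR i α (λ j → GL i j α (identity (i + j) α Γ))
identity i (F α) Γ = FL i α (λ j → FR i j α (identity (i + j) α Γ))
identity i (X α) Γ = identity (suc i) α Γ

¬L⁻¹ : SLTω (¬ φ ∷ Γ) nothing → SLTω Γ (just φ)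
¬L⁻¹ {φ} {Γ} d = exm 0 φ (weR φ d) (identity 0 φ Γ)

contradict : ¬ φ ∈ Γ → SLTω Γ (just φ) → SLTω Γ nothing
contradict ¬φ∈Γ d = contract ¬φ∈Γ (¬L 0 _ d)

mutual
  LTω⇒SLTω : LTω Γ Δ → ¬* Δ ⊆ Σ → Γ ⊆ Σ → SLTω Σ nothing
  LTω⇒SLTω (set (Γ₀⊆Γ , _) (Δ₀⊆Δ , _) d) n g =
    LTω⇒SLTω d (⊆-trans (map⁺ ¬_ Δ₀⊆Δ) n) (⊆-trans Γ₀⊆Γ g)
  LTω⇒SLTω (init i p) n g = contradict (n (here refl)) (contract (g (here refl)) (init i p))
  LTω⇒SLTω (weL α d) n g = LTω⇒SLTω d n (∷⊆⇒⊆ g)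
  LTω⇒SLTω (weR α d) n g = LTω⇒SLTω d (∷⊆⇒⊆ n) g
  LTω⇒SLTω (⇒L i α β d e) n g = contract (g (here refl))
    (⇒L i α β (LTω⇒SLTω-succedent d n (∷⊆⇒⊆ g))
              (LTω⇒SLTω e (⊆⇒⊆∷ n) (∷⁺ʳ _ (∷⊆⇒⊆ g))))
  LTω⇒SLTω (¬L i α d) n g = contract (g (here refl))
    (¬L i α (LTω⇒SLTω-succedent d n (∷⊆⇒⊆ g)))
  LTω⇒SLTω (∧L i α β d) n g = contract (g (here refl))
    (∧L i α β (LTω⇒SLTω d (⊆⇒⊆∷ (⊆⇒⊆∷ n)) (∷⁺ʳ _ (∷⁺ʳ _ (∷⊆⇒⊆ g)))))
  LTω⇒SLTω (∨L i α β d e) n g = contract (g (here refl))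
    (∨L i α β (LTω⇒SLTω d (⊆⇒⊆∷ n) (∷⁺ʳ _ (∷⊆⇒⊆ g)))
              (LTω⇒SLTω e (⊆⇒⊆∷ n) (∷⁺ʳ _ (∷⊆⇒⊆ g))))
  LTω⇒SLTω (GL i k α d) n g = contract (g (here refl))
    (GL i k α (LTω⇒SLTω d (⊆⇒⊆∷ n) (∷⁺ʳ _ (∷⊆⇒⊆ g))))
  LTω⇒SLTω (FL i α d) n g = contract (g (here refl))
    (FL i α (λ j → LTω⇒SLTω (d j) (⊆⇒⊆∷ n) (∷⁺ʳ _ (∷⊆⇒⊆ g))))
  LTω⇒SLTω (⇒R i α β d) n g = contradict (n (here refl))
    (⇒R i α β (LTω⇒SLTω-succedent d (⊆⇒⊆∷ (∷⊆⇒⊆ n)) (∷⁺ʳ _ g)))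
  LTω⇒SLTω (¬R i α d) n g = contradict (n (here refl))
    (¬R i α (LTω⇒SLTω d (⊆⇒⊆∷ (∷⊆⇒⊆ n)) (∷⁺ʳ _ g)))
  LTω⇒SLTω (∧R i α β d e) n g = contradict (n (here refl))
    (∧R i α β (LTω⇒SLTω-succedent d (∷⊆⇒⊆ n) g) (LTω⇒SLTω-succedent e (∷⊆⇒⊆ n) g))
  LTω⇒SLTω {Σ = Σ} (∨R i α β d) n g = contradict (n (here refl))
    (exm 0 (Xⁿ i β)
      (∨R₁ i α β (LTω⇒SLTω-succedent d (∷⁺ʳ _ (∷⊆⇒⊆ n)) (⊆⇒⊆∷ g)))
      (∨R₂ i α β (identity i β Σ)))
  LTω⇒SLTω (GR i α d) n g = contradict (n (here refl))
    (GR i α (λ j → LTω⇒SLTω-succedent (d j) (∷⊆⇒⊆ n) g))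
  LTω⇒SLTω (FR i k α d) n g = contradict (n (here refl))
    (FR i k α (LTω⇒SLTω-succedent d (∷⊆⇒⊆ n) g))

  LTω⇒SLTω-succedent : LTω Γ (φ ∷ Δ) → ¬* Δ ⊆ Σ → Γ ⊆ Σ → SLTω Σ (just φ)
  LTω⇒SLTω-succedent d n g = ¬L⁻¹ (LTω⇒SLTω d (∷⁺ʳ _ n) (⊆⇒⊆∷ g))

lemma1 : (Γ Δ : List Formula) → LTω Γ Δ → SLTω (¬* Δ ++ Γ) nothing
lemma1 Γ Δ d = LTω⇒SLTω d (xs⊆xs++ys (¬* Δ) Γ) (xs⊆ys++xs Γ (¬* Δ))
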